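{- Let $\mathcal{M}=(N,\mathcal{I}(\mathcal{M}))$ be a matroid, $f:2^N\to\mathbb{R}_{\ge0}$ monotone submodular, $B_0$ a basis of $\mathcal{M}$ partitioned as $B_0=H_1\cup H_2$ (disjoint), and $O^\star\in\arg\max_{S\in\mathcal{I}(\mathcal{M})}f(S)$. Then $f(O^\star)\le\max_{S\in\mathcal{I}_{H_1}(\mathcal{M})}h_{H_1}(S)+\max_{S\in\mathcal{I}_{H_2}(\mathcal{M})}h_{H_2}(S)$.
   Context: For $H\subseteq N$: $\mathcal{I}_H(\mathcal{M})=\{S\subseteq N\setminus H:S\cup H\in\mathcal{I}(\mathcal{M})\}$ and $h_H(S)=\frac1{2^{|H|}}\sum_{H_j\subseteq H}f(S\cup H_j)$ for $S\subseteq N\setminus H$. A basis is a maximal independent set. Monotone and submodular have their standard meanings.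
   Formalization: The monotone submodular function f takes values in the nonnegative rationals instead of $\mathbb{R}_{\ge0}$. -}

module Defs where

open import Data.Nat using (ℕ; zero; suc; _^_; _<_)
open import Data.Nat.Properties using (m^n≢0)
open import Data.Integer using (+_)
open import Data.Rational using (ℚ; 0ℚ; _+_; _*_; _≤_; _/_)
open import Data.Fin using (Fin)
open import Data.Fin.Subset using (Subset; _∈_; _∉_; _⊆_; _∪_; _∩_; ⁅_⁆; ⊥; ∣_∣; inside; outside)
open import Data.Vec using ([]; _∷_)
open import Data.List using (List; map; foldr; _++_) renaming ([] to []ᴸ; _∷_ to _∷ᴸ_)
open import Data.Product using (Σ; _×_; ∃-syntax)
open import Relation.Binary.PropositionalEquality using (_≡_)
open import Relation.Nullary using (¬_)

record Matroid (n : ℕ) : Set₁ where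
  field
    Indep      : Subset n → Set
    indep-∅    : Indep ⊥
    indep-⊆    : ∀ {A B} → A ⊆ B → Indep B → Indep A
    indep-exch : ∀ {A B} → Indep A → Indep B → ∣ A ∣ < ∣ B ∣ →
                 ∃[ x ] (x ∈ B × x ∉ A × Indep (A ∪ ⁅ x ⁆))
open Matroid public

IsBasis : ∀ {n} → Matroid n → Subset n → Set
IsBasis M B = Indep M B × (∀ T → Indep M T → B ⊆ T → T ⊆ B)

SetFun : ℕ → Set
SetFun n = Subset n → ℚ

NonNeg : ∀ {n} → SetFun n → Set
NonNeg f = ∀ S → 0ℚ ≤ f S

Monotone : ∀ {n} → SetFun n → Set
Monotone f = ∀ S T → S ⊆ T → f S ≤ f T

Submodular : ∀ {n} → SetFun n → Set
Submodular f = ∀ S T → f (S ∪ T) + f (S ∩ T) ≤ f S + f T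

IsArgMax : ∀ {n} → Matroid n → SetFun n → Subset n → Set
IsArgMax M f O = Indep M O × (∀ S → Indep M S → f S ≤ f O)

IndepRel : ∀ {n} → Matroid n → Subset n → Subset n → Set
IndepRel M H S = (S ∩ H ≡ ⊥) × Indep M (S ∪ H)

subsetsOf : ∀ {n} → Subset n → List (Subset n)
subsetsOf []             = [] ∷ᴸ []ᴸ
subsetsOf (outside ∷ H) = map (outside ∷_) (subsetsOf H)
subsetsOf (inside ∷ H)  = map (outside ∷_) (subsetsOf H) ++ map (inside ∷_) (subsetsOf H)

sumℚ : List ℚ → ℚ
sumℚ = foldr _+_ 0ℚ

h : ∀ {n} → SetFun n → Subset n → Subset n → ℚ
h f H S = _/_ (+ 1) (2 ^ ∣ H ∣) {{m^n≢0 2 ∣ H ∣}} * sumℚ (map (λ Hj → f (S ∪ Hj)) (subsetsOf H))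

-- For monotone, submodular, nonnegative f we have f O ≤ f S₁ + f S₂ whenever O ⊆ S₁ ∪ S₂, and
-- f S ≤ h_H(S) because h_H(S) averages the values f (S ∪ Hⱼ) ≥ f S. So it suffices to cover the
-- independent set O by some S₁ ∈ I_{H₁}(M) and S₂ ∈ I_{H₂}(M), i.e. by an independent set of each of
-- the contractions M / H₁ and M / H₂. By Rado's matroid partition theorem this is possible when
-- |A| + |H₁| + |H₂| ≤ r(A ∪ H₁) + r(A ∪ H₂) for all A ⊆ O, and by submodularity of the rank the right
-- side is at least r(A ∪ B₀) + r(A) = |B₀| + |A|. The partition theorem is proved by induction on |O|:
-- if the condition is tight on a nonempty proper subset A, cover A and then O ∖ A over the enlarged
-- contracted sets; otherwise there is slack everywhere and one element of O can be moved into H₁ or H₂.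

module Submission where

open import Defs
open import Data.Nat using (ℕ)
open import Data.Fin using (Fin)
open import Data.Vec using ([]; _∷_; here; there)
open import Data.Fin.Subset
  using (Subset; _∈_; _∉_; _⊆_; _∪_; _∩_; _─_; _-_; ⁅_⁆; ⊥; ∣_∣; inside; outside; Nonempty; Empty)
open import Data.Fin.Subset.Properties
open import Data.Product using (_×_; _,_; proj₁; proj₂; ∃-syntax)
open import Data.Sum using (_⊎_; inj₁; inj₂; [_,_]; swap)
open import Relation.Binary.PropositionalEquality
  using (_≡_; refl; sym; trans; cong; cong₂; subst; subst₂; module ≡-Reasoning)
open import Relation.Nullary using (¬_; Dec; yes; no; contradiction)
open import Relation.Unary using (Pred; Decidable)
open import Data.List using ([]; _∷_)
open import Data.List.Relation.Unary.All as All using ([]; _∷_)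

private
  variable
    n : ℕ
    p q r s : Subset n

module _ where
  open import Data.Nat using (suc; _+_; _≤_)
  open import Data.Nat.Properties using (+-comm; +-suc; +-identityʳ; m≤m+n; ≤-trans; ≤-reflexive)

  Disjoint : Subset n → Subset n → Set
  Disjoint p q = ∀ {x} → x ∈ p → x ∉ q

  Disjoint⇒∩≡⊥ : Disjoint p q → p ∩ q ≡ ⊥
  Disjoint⇒∩≡⊥ {p = p} {q} p#q =
    Empty-unique λ (x , x∈p∩q) → let x∈p , x∈q = x∈p∩q⁻ p q x∈p∩q in p#q x∈p x∈q

  ∪-least : p ⊆ r → q ⊆ r → p ∪ q ⊆ r
  ∪-least {p = p} {q = q} p⊆r q⊆r x∈p∪q = [ p⊆r , q⊆r ] (x∈p∪q⁻ p q x∈p∪q)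

  ∪-mono : p ⊆ r → q ⊆ s → p ∪ q ⊆ r ∪ s
  ∪-mono {r = r} {s = s} p⊆r q⊆s = ∪-least (⊆-trans p⊆r (p⊆p∪q s)) (⊆-trans q⊆s (q⊆p∪q r s))

  ∩-greatest : r ⊆ p → r ⊆ q → r ⊆ p ∩ q
  ∩-greatest r⊆p r⊆q x∈r = x∈p∩q⁺ (r⊆p x∈r , r⊆q x∈r)

  ∣p∪q∣+∣p∩q∣≡∣p∣+∣q∣ : ∀ (p q : Subset n) → ∣ p ∪ q ∣ + ∣ p ∩ q ∣ ≡ ∣ p ∣ + ∣ q ∣
  ∣p∪q∣+∣p∩q∣≡∣p∣+∣q∣ []            []            = refl
  ∣p∪q∣+∣p∩q∣≡∣p∣+∣q∣ (outside ∷ p) (outside ∷ q) = ∣p∪q∣+∣p∩q∣≡∣p∣+∣q∣ p q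
  ∣p∪q∣+∣p∩q∣≡∣p∣+∣q∣ (outside ∷ p) (inside  ∷ q) =
    trans (cong suc (∣p∪q∣+∣p∩q∣≡∣p∣+∣q∣ p q)) (sym (+-suc ∣ p ∣ ∣ q ∣))
  ∣p∪q∣+∣p∩q∣≡∣p∣+∣q∣ (inside  ∷ p) (outside ∷ q) = cong suc (∣p∪q∣+∣p∩q∣≡∣p∣+∣q∣ p q)
  ∣p∪q∣+∣p∩q∣≡∣p∣+∣q∣ (inside  ∷ p) (inside  ∷ q) = cong suc (begin
    ∣ p ∪ q ∣ + suc ∣ p ∩ q ∣   ≡⟨ +-suc ∣ p ∪ q ∣ ∣ p ∩ q ∣ ⟩
    suc (∣ p ∪ q ∣ + ∣ p ∩ q ∣) ≡⟨ cong suc (∣p∪q∣+∣p∩q∣≡∣p∣+∣q∣ p q) ⟩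
    suc (∣ p ∣ + ∣ q ∣)         ≡⟨ +-suc ∣ p ∣ ∣ q ∣ ⟨
    ∣ p ∣ + suc ∣ q ∣           ∎)
    where open ≡-Reasoning

  ∣p∪q∣≤∣p∣+∣q∣ : ∀ (p q : Subset n) → ∣ p ∪ q ∣ ≤ ∣ p ∣ + ∣ q ∣
  ∣p∪q∣≤∣p∣+∣q∣ p q = ≤-trans (m≤m+n ∣ p ∪ q ∣ ∣ p ∩ q ∣) (≤-reflexive (∣p∪q∣+∣p∩q∣≡∣p∣+∣q∣ p q))

  p∩q≡⊥⇒∣p∪q∣≡∣p∣+∣q∣ : ∀ (p q : Subset n) → p ∩ q ≡ ⊥ → ∣ p ∪ q ∣ ≡ ∣ p ∣ + ∣ q ∣
  p∩q≡⊥⇒∣p∪q∣≡∣p∣+∣q∣ {n} p q p∩q≡⊥ = begin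
    ∣ p ∪ q ∣             ≡⟨ +-identityʳ ∣ p ∪ q ∣ ⟨
    ∣ p ∪ q ∣ + 0         ≡⟨ cong (∣ p ∪ q ∣ +_) (trans (cong ∣_∣ p∩q≡⊥) (∣⊥∣≡0 n)) ⟨
    ∣ p ∪ q ∣ + ∣ p ∩ q ∣ ≡⟨ ∣p∪q∣+∣p∩q∣≡∣p∣+∣q∣ p q ⟩
    ∣ p ∣ + ∣ q ∣         ∎
    where open ≡-Reasoning

  Disjoint⇒∣p∪q∣≡∣p∣+∣q∣ : Disjoint p q → ∣ p ∪ q ∣ ≡ ∣ p ∣ + ∣ q ∣
  Disjoint⇒∣p∪q∣≡∣p∣+∣q∣ {p = p} {q} p#q = p∩q≡⊥⇒∣p∪q∣≡∣p∣+∣q∣ p q (Disjoint⇒∩≡⊥ p#q)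

  x∈p⇒⁅x⁆⊆p : ∀ {x : Fin n} → x ∈ p → ⁅ x ⁆ ⊆ p
  x∈p⇒⁅x⁆⊆p {p = p} {x} x∈p y∈⁅x⁆ = subst (_∈ p) (sym (x∈⁅y⁆⇒x≡y x y∈⁅x⁆)) x∈p

  x∉p⇒Disjoint⁅x⁆p : ∀ {x : Fin n} → x ∉ p → Disjoint ⁅ x ⁆ p
  x∉p⇒Disjoint⁅x⁆p {p = p} {x} x∉p y∈⁅x⁆ = subst (_∉ p) (sym (x∈⁅y⁆⇒x≡y x y∈⁅x⁆)) x∉p

  x∉p⇒∣⁅x⁆∪p∣≡1+∣p∣ : ∀ {x : Fin n} → x ∉ p → ∣ ⁅ x ⁆ ∪ p ∣ ≡ suc ∣ p ∣
  x∉p⇒∣⁅x⁆∪p∣≡1+∣p∣ {p = p} {x} x∉p =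
    trans (Disjoint⇒∣p∪q∣≡∣p∣+∣q∣ (x∉p⇒Disjoint⁅x⁆p x∉p)) (cong (_+ ∣ p ∣) (∣⁅x⁆∣≡1 x))

  x∈p─q⇒x∉q : ∀ (p q : Subset n) {x} → x ∈ p ─ q → x ∉ q
  x∈p─q⇒x∉q (_ ∷ p) (inside ∷ q) () here
  x∈p─q⇒x∉q (_ ∷ p) (_ ∷ q) (there x∈p─q) (there x∈q) = x∈p─q⇒x∉q p q x∈p─q x∈q

module _ where
  open import Data.Nat using (zero; suc; _+_; _^_; _⊔_; _≤_; _<_; z≤n; s≤s)
  open import Data.Nat.Properties
  open import Function using (_∘_)
  open import Level using (0ℓ)

  maximum : ∀ {m} → (Subset m → ℕ) → ℕ
  maximum {zero}  g = g []
  maximum {suc m} g = maximum (g ∘ (outside ∷_)) ⊔ maximum (g ∘ (inside ∷_))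

  ≤maximum : ∀ {m} (g : Subset m → ℕ) X → g X ≤ maximum g
  ≤maximum g []            = ≤-refl
  ≤maximum g (outside ∷ X) = ≤-trans (≤maximum (g ∘ (outside ∷_)) X) (m≤m⊔n _ _)
  ≤maximum g (inside  ∷ X) = ≤-trans (≤maximum (g ∘ (inside ∷_)) X) (m≤n⊔m _ _)

  maximum-attained : ∀ {m} (g : Subset m → ℕ) → ∃[ X ] maximum g ≡ g X
  maximum-attained {zero}  g = [] , refl
  maximum-attained {suc m} g with ⊔-sel (maximum (g ∘ (outside ∷_))) (maximum (g ∘ (inside ∷_)))
  ... | inj₁ eq = let X , attained = maximum-attained (g ∘ (outside ∷_)) in outside ∷ X , trans eq attained
  ... | inj₂ eq = let X , attained = maximum-attained (g ∘ (inside ∷_)) in inside ∷ X , trans eq attained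

  count : ∀ {m} {P : Pred (Subset m) 0ℓ} → Decidable P → ℕ
  count {zero}  P? with P? []
  ... | yes _ = 1
  ... | no  _ = 0
  count {suc m} P? = count (P? ∘ (outside ∷_)) + count (P? ∘ (inside ∷_))

  count≤2^ : ∀ {m} {P : Pred (Subset m) 0ℓ} (P? : Decidable P) → count P? ≤ 2 ^ m
  count≤2^ {zero}  P? with P? []
  ... | yes _ = ≤-refl
  ... | no  _ = z≤n
  count≤2^ {suc m} P? = subst (count P? ≤_) (cong (2 ^ m +_) (sym (+-identityʳ (2 ^ m))))
    (+-mono-≤ (count≤2^ (P? ∘ (outside ∷_))) (count≤2^ (P? ∘ (inside ∷_))))

  count-mono : ∀ {m} {P Q : Pred (Subset m) 0ℓ} (P? : Decidable P) (Q? : Decidable Q) →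
               (∀ {X} → P X → Q X) → count P? ≤ count Q?
  count-mono {zero} P? Q? P⇒Q with P? [] | Q? []
  ... | yes p | yes _ = ≤-refl
  ... | yes p | no ¬q = contradiction (P⇒Q p) ¬q
  ... | no  _ | _     = z≤n
  count-mono {suc m} P? Q? P⇒Q =
    +-mono-≤ (count-mono (P? ∘ (outside ∷_)) (Q? ∘ (outside ∷_)) P⇒Q)
             (count-mono (P? ∘ (inside ∷_)) (Q? ∘ (inside ∷_)) P⇒Q)

  count-mono-< : ∀ {m} {P Q : Pred (Subset m) 0ℓ} (P? : Decidable P) (Q? : Decidable Q) →
                 (∀ {X} → P X → Q X) → ∀ X → Q X → ¬ P X → count P? < count Q?
  count-mono-< {zero} P? Q? P⇒Q [] q ¬p with P? [] | Q? []
  ... | yes p | _     = contradiction p ¬p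
  ... | no  _ | yes _ = s≤s z≤n
  ... | no  _ | no ¬q = contradiction q ¬q
  count-mono-< {suc m} P? Q? P⇒Q (outside ∷ X) q ¬p =
    +-mono-<-≤ (count-mono-< (P? ∘ (outside ∷_)) (Q? ∘ (outside ∷_)) P⇒Q X q ¬p)
               (count-mono (P? ∘ (inside ∷_)) (Q? ∘ (inside ∷_)) P⇒Q)
  count-mono-< {suc m} P? Q? P⇒Q (inside ∷ X) q ¬p =
    +-mono-≤-< (count-mono (P? ∘ (outside ∷_)) (Q? ∘ (outside ∷_)) P⇒Q)
               (count-mono-< (P? ∘ (inside ∷_)) (Q? ∘ (inside ∷_)) P⇒Q X q ¬p)

module Rank {n : ℕ} (M : Matroid n) (indep? : Decidable (Indep M)) where
  open import Data.Nat using (zero; suc; _+_; _≤_; _<_; _<?_)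
  open import Data.Nat.Properties
  open import Relation.Nullary.Decidable using (_×-dec_; ¬?)

  private
    variable
      I X Y Z : Subset n
      x : Fin n

    sizeIfIndepIn : Subset n → Subset n → ℕ
    sizeIfIndepIn X I with (I ⊆? X) ×-dec indep? I
    ... | yes _ = ∣ I ∣
    ... | no  _ = 0

  rank : Subset n → ℕ
  rank X = maximum (sizeIfIndepIn X)

  ∣I∣≤rank : I ⊆ X → Indep M I → ∣ I ∣ ≤ rank X
  ∣I∣≤rank {I} {X} I⊆X I-indep = ≤-trans ∣I∣≤size (≤maximum (sizeIfIndepIn X) I)
    where
    ∣I∣≤size : ∣ I ∣ ≤ sizeIfIndepIn X I
    ∣I∣≤size with (I ⊆? X) ×-dec indep? I
    ... | yes _ = ≤-refl
    ... | no ¬p = contradiction ((λ {x} → I⊆X {x}) , I-indep) ¬p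

  rank-attained : ∀ X → ∃[ W ] (W ⊆ X × Indep M W × ∣ W ∣ ≡ rank X)
  rank-attained X with maximum-attained (sizeIfIndepIn X)
  ... | I , rank≡size with (I ⊆? X) ×-dec indep? I
  ...   | yes (I⊆X , I-indep) = I , I⊆X , I-indep , sym rank≡size
  ...   | no _                = ⊥ , ⊥⊆ , indep-∅ M , trans (∣⊥∣≡0 n) (sym rank≡size)

  rank-mono : X ⊆ Y → rank X ≤ rank Y
  rank-mono {X} X⊆Y with rank-attained X
  ... | W , W⊆X , W-indep , ∣W∣≡rank = subst (_≤ _) ∣W∣≡rank (∣I∣≤rank (⊆-trans W⊆X X⊆Y) W-indep)

  Addable : Subset n → Fin n → Set
  Addable I x = x ∉ I × Indep M (⁅ x ⁆ ∪ I)

  addable? : ∀ I x → Dec (Addable I x)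
  addable? I x = ¬? (x ∈? I) ×-dec indep? (⁅ x ⁆ ∪ I)

  rank-exchange : Indep M I → ∣ I ∣ < rank X → ∃[ x ] (x ∈ X × Addable I x)
  rank-exchange {I} {X} I-indep ∣I∣<rank with rank-attained X
  ... | W , W⊆X , W-indep , ∣W∣≡rank
    with indep-exch M I-indep W-indep (subst (∣ I ∣ <_) (sym ∣W∣≡rank) ∣I∣<rank)
  ...   | y , y∈W , y∉I , I+y-indep = y , W⊆X y∈W , y∉I , subst (Indep M) (∪-comm I ⁅ y ⁆) I+y-indep

  augment : Indep M I → I ⊆ X → ∃[ J ] (I ⊆ J × J ⊆ X × Indep M J × rank X ≤ ∣ J ∣)
  augment {I} {X} I-indep I⊆X = go (rank X) I-indep I⊆X (m≤m+n (rank X) ∣ I ∣)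
    where
    go : ∀ k {I} → Indep M I → I ⊆ X → rank X ≤ k + ∣ I ∣ →
         ∃[ J ] (I ⊆ J × J ⊆ X × Indep M J × rank X ≤ ∣ J ∣)
    go zero    I-indep I⊆X rank≤ = _ , ⊆-refl , I⊆X , I-indep , rank≤
    go (suc k) {I} I-indep I⊆X rank≤ with ∣ I ∣ <? rank X
    ... | no ∣I∣≮rank = I , ⊆-refl , I⊆X , I-indep , ≮⇒≥ ∣I∣≮rank
    ... | yes ∣I∣<rank with rank-exchange I-indep ∣I∣<rank
    ...   | y , y∈X , y∉I , y+I-indep =
      let J , y+I⊆J , J-augments = go k y+I-indep (∪-least (x∈p⇒⁅x⁆⊆p y∈X) I⊆X) rank≤k+∣y+I∣
      in J , ⊆-trans (q⊆p∪q ⁅ y ⁆ I) y+I⊆J , J-augments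
      where
      rank≤k+∣y+I∣ : rank X ≤ k + ∣ ⁅ y ⁆ ∪ I ∣
      rank≤k+∣y+I∣ = begin
        rank X            ≤⟨ rank≤ ⟩
        suc k + ∣ I ∣     ≡⟨ +-suc k ∣ I ∣ ⟨
        k + suc ∣ I ∣     ≡⟨ cong (k +_) (x∉p⇒∣⁅x⁆∪p∣≡1+∣p∣ y∉I) ⟨
        k + ∣ ⁅ y ⁆ ∪ I ∣ ∎
        where open ≤-Reasoning

  ¬Addable⇒rank[⁅x⁆∪I]≤∣I∣ : Indep M I → ¬ Addable I x → rank (⁅ x ⁆ ∪ I) ≤ ∣ I ∣
  ¬Addable⇒rank[⁅x⁆∪I]≤∣I∣ {I} {x} I-indep ¬addable with ∣ I ∣ <? rank (⁅ x ⁆ ∪ I)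
  ... | no ∣I∣≮rank = ≮⇒≥ ∣I∣≮rank
  ... | yes ∣I∣<rank with rank-exchange I-indep ∣I∣<rank
  ...   | y , y∈⁅x⁆∪I , y∉I , y+I-indep = contradiction (subst (Addable I) y≡x (y∉I , y+I-indep)) ¬addable
    where
    y≡x : y ≡ x
    y≡x = [ x∈⁅y⁆⇒x≡y x , (λ y∈I → contradiction y∈I y∉I) ] (x∈p∪q⁻ ⁅ x ⁆ I y∈⁅x⁆∪I)

  rank-submodular : ∀ X Y → rank (X ∪ Y) + rank (X ∩ Y) ≤ rank X + rank Y
  rank-submodular X Y with rank-attained (X ∩ Y)
  ... | I , I⊆X∩Y , I-indep , ∣I∣≡rank with augment I-indep (⊆-trans I⊆X∩Y (⊆-trans (p∩q⊆p X Y) (p⊆p∪q Y)))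
  ...   | J , I⊆J , J⊆X∪Y , J-indep , rank≤∣J∣ = begin
    rank (X ∪ Y) + rank (X ∩ Y)                  ≤⟨ +-mono-≤ rank≤∣J∣ (≤-reflexive (sym ∣I∣≡rank)) ⟩
    ∣ J ∣ + ∣ I ∣                                ≤⟨ +-mono-≤ (p⊆q⇒∣p∣≤∣q∣ J⊆JX∪JY) (p⊆q⇒∣p∣≤∣q∣ I⊆JX∩JY) ⟩
    ∣ (J ∩ X) ∪ (J ∩ Y) ∣ + ∣ (J ∩ X) ∩ (J ∩ Y) ∣ ≡⟨ ∣p∪q∣+∣p∩q∣≡∣p∣+∣q∣ (J ∩ X) (J ∩ Y) ⟩
    ∣ J ∩ X ∣ + ∣ J ∩ Y ∣                        ≤⟨ +-mono-≤ (∣J∩Z∣≤rank X) (∣J∩Z∣≤rank Y) ⟩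
    rank X + rank Y                              ∎
    where
    open ≤-Reasoning
    ∣J∩Z∣≤rank : ∀ Z → ∣ J ∩ Z ∣ ≤ rank Z
    ∣J∩Z∣≤rank Z = ∣I∣≤rank (p∩q⊆q J Z) (indep-⊆ M (p∩q⊆p J Z) J-indep)
    J⊆JX∪JY : J ⊆ (J ∩ X) ∪ (J ∩ Y)
    J⊆JX∪JY = ⊆-trans (∩-greatest ⊆-refl J⊆X∪Y) (⊆-reflexive (∩-distribˡ-∪ J X Y))
    I⊆JX∩JY : I ⊆ (J ∩ X) ∩ (J ∩ Y)
    I⊆JX∩JY = ∩-greatest (∩-greatest I⊆J (⊆-trans I⊆X∩Y (p∩q⊆p X Y)))
                         (∩-greatest I⊆J (⊆-trans I⊆X∩Y (p∩q⊆q X Y)))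

  rank-∪-spanned : I ⊆ Y → Indep M I → rank Y ≤ ∣ I ∣ → rank (Z ∪ Y) ≤ rank (Z ∪ I)
  rank-∪-spanned {I} {Y} {Z} I⊆Y I-indep rank≤∣I∣ = +-cancelʳ-≤ ∣ I ∣ (rank (Z ∪ Y)) (rank (Z ∪ I)) (begin
    rank (Z ∪ Y) + ∣ I ∣                    ≤⟨ +-mono-≤ (rank-mono Z∪Y⊆) (∣I∣≤rank I⊆ I-indep) ⟩
    rank ((Z ∪ I) ∪ Y) + rank ((Z ∪ I) ∩ Y) ≤⟨ rank-submodular (Z ∪ I) Y ⟩
    rank (Z ∪ I) + rank Y                   ≤⟨ +-monoʳ-≤ (rank (Z ∪ I)) rank≤∣I∣ ⟩
    rank (Z ∪ I) + ∣ I ∣                    ∎)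
    where
    open ≤-Reasoning
    Z∪Y⊆ : Z ∪ Y ⊆ (Z ∪ I) ∪ Y
    Z∪Y⊆ = ∪-least (⊆-trans (p⊆p∪q I) (p⊆p∪q Y)) (q⊆p∪q (Z ∪ I) Y)
    I⊆ : I ⊆ (Z ∪ I) ∩ Y
    I⊆ = ∩-greatest (q⊆p∪q Z I) I⊆Y

module Partition {n : ℕ} (M : Matroid n) (indep? : Decidable (Indep M)) where
  open Rank M indep?
  open import Data.Nat using (zero; suc; _+_; _≤_; _<_; _≰_; _≟_; _<?_)
  open import Data.Nat.Properties
  open import Algebra.Properties.CommutativeSemigroup +-commutativeSemigroup using (interchange)
  open import Relation.Nullary.Decidable using (_×-dec_)
  open import Data.Product using (map₂)
  open import Function using (_∘_)

  private
    variable
      A E K K₁ K₂ S T : Subset n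
      e : Fin n

  -- rank (A ∪ K) ∸ ∣ K ∣ is the rank of A in the contraction M / K (for independent K), so this is
  -- Rado's condition for E to be covered by an independent set of M / K₁ and one of M / K₂.
  RadoCondition : (K₁ K₂ E : Subset n) → Set
  RadoCondition K₁ K₂ E = ∀ A → A ⊆ E → ∣ A ∣ + (∣ K₁ ∣ + ∣ K₂ ∣) ≤ rank (A ∪ K₁) + rank (A ∪ K₂)

  record IndepOver (K E S : Subset n) : Set where
    field
      ⊆E       : S ⊆ E
      disjoint : Disjoint S K
      indep    : Indep M (S ∪ K)

  record Cover (K₁ K₂ E : Subset n) : Set where
    field
      {S₁ S₂} : Subset n
      part₁   : IndepOver K₁ E S₁
      part₂   : IndepOver K₂ E S₂
      covers  : E ⊆ S₁ ∪ S₂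

  open IndepOver
  open Cover

  indepOver-⊥ : Indep M K → IndepOver K E ⊥
  indepOver-⊥ K-indep = record
    { ⊆E       = ⊥⊆
    ; disjoint = λ x∈⊥ → contradiction x∈⊥ ∉⊥
    ; indep    = indep-⊆ M (∪-least ⊥⊆ ⊆-refl) K-indep
    }

  indepOver-∪ : A ⊆ E → IndepOver K A S → IndepOver (S ∪ K) (E ─ A) T → IndepOver K E (S ∪ T)
  indepOver-∪ {A} {E} {K} {S} {T} A⊆E S-over T-over = record
    { ⊆E       = ∪-least (⊆-trans (⊆E S-over) A⊆E) (⊆-trans (⊆E T-over) (p─q⊆p E A))
    ; disjoint = λ x∈S∪T x∈K → [ (λ x∈S → disjoint S-over x∈S x∈K)
                                 , (λ x∈T → disjoint T-over x∈T (q⊆p∪q S K x∈K)) ] (x∈p∪q⁻ S T x∈S∪T)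
    ; indep    = indep-⊆ M (∪-least (∪-least (⊆-trans (p⊆p∪q K) (q⊆p∪q T (S ∪ K))) (p⊆p∪q (S ∪ K)))
                                    (⊆-trans (q⊆p∪q S K) (q⊆p∪q T (S ∪ K))))
                   (indep T-over)
    }

  cover-∅ : Indep M K₁ → Indep M K₂ → Empty E → Cover K₁ K₂ E
  cover-∅ K₁-indep K₂-indep E-empty = record
    { part₁  = indepOver-⊥ K₁-indep
    ; part₂  = indepOver-⊥ K₂-indep
    ; covers = λ {x} x∈E → contradiction (x , x∈E) E-empty
    }

  cover-swap : Cover K₂ K₁ E → Cover K₁ K₂ E
  cover-swap C = record
    { part₁  = part₂ C
    ; part₂  = part₁ C
    ; covers = λ x∈E → x∈p∪q⁺ (swap (x∈p∪q⁻ (S₁ C) (S₂ C) (covers C x∈E)))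
    }

  cover-∪ : A ⊆ E → (C : Cover K₁ K₂ A) → Cover (S₁ C ∪ K₁) (S₂ C ∪ K₂) (E ─ A) → Cover K₁ K₂ E
  cover-∪ {A} {E} A⊆E C D = record
    { part₁  = indepOver-∪ A⊆E (part₁ C) (part₁ D)
    ; part₂  = indepOver-∪ A⊆E (part₂ C) (part₂ D)
    ; covers = covers-E
    }
    where
    covers-E : E ⊆ (S₁ C ∪ S₁ D) ∪ (S₂ C ∪ S₂ D)
    covers-E {x} x∈E with x ∈? A
    ... | yes x∈A = ∪-mono (p⊆p∪q (S₁ D)) (p⊆p∪q (S₂ D)) (covers C x∈A)
    ... | no  x∉A = ∪-mono (q⊆p∪q (S₁ C) (S₁ D)) (q⊆p∪q (S₂ C) (S₂ D)) (covers D (x∈p∧x∉q⇒x∈p─q x∈E x∉A))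

  cover-insert : e ∈ E → Addable K₁ e → Indep M K₂ → Cover (⁅ e ⁆ ∪ K₁) K₂ (E - e) → Cover K₁ K₂ E
  cover-insert {e} {E} {K₁} {K₂} e∈E (e∉K₁ , e+K₁-indep) K₂-indep C =
    cover-∪ (x∈p⇒⁅x⁆⊆p e∈E) cover-⁅e⁆ (subst (λ K → Cover (⁅ e ⁆ ∪ K₁) K (E - e)) (sym (∪-identityˡ K₂)) C)
    where
    cover-⁅e⁆ : Cover K₁ K₂ ⁅ e ⁆
    cover-⁅e⁆ = record
      { part₁  = record { ⊆E = ⊆-refl ; disjoint = x∉p⇒Disjoint⁅x⁆p e∉K₁ ; indep = e+K₁-indep }
      ; part₂  = indepOver-⊥ K₂-indep
      ; covers = p⊆p∪q ⊥
      }

  rado-swap : RadoCondition K₂ K₁ E → RadoCondition K₁ K₂ E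
  rado-swap {K₂} {K₁} rado A A⊆E =
    subst₂ _≤_ (cong (∣ A ∣ +_) (+-comm ∣ K₂ ∣ ∣ K₁ ∣)) (+-comm (rank (A ∪ K₂)) (rank (A ∪ K₁))) (rado A A⊆E)

  rado⇒addable : RadoCondition K₁ K₂ E → Indep M K₁ → Indep M K₂ → e ∈ E → Addable K₁ e ⊎ Addable K₂ e
  rado⇒addable {K₁} {K₂} {e = e} rado K₁-indep K₂-indep e∈E with addable? K₁ e | addable? K₂ e
  ... | yes e-addable₁ | _              = inj₁ e-addable₁
  ... | no  _          | yes e-addable₂ = inj₂ e-addable₂
  ... | no  ¬addable₁  | no  ¬addable₂  = contradiction
    (≤-trans (rado ⁅ e ⁆ (x∈p⇒⁅x⁆⊆p e∈E))
             (+-mono-≤ (¬Addable⇒rank[⁅x⁆∪I]≤∣I∣ K₁-indep ¬addable₁)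
                       (¬Addable⇒rank[⁅x⁆∪I]≤∣I∣ K₂-indep ¬addable₂)))
    (subst (λ k → k + (∣ K₁ ∣ + ∣ K₂ ∣) ≰ ∣ K₁ ∣ + ∣ K₂ ∣) (sym (∣⁅x⁆∣≡1 e)) 1+n≰n)

  Tight : (K₁ K₂ E A : Subset n) → Set
  Tight K₁ K₂ E A = A ⊆ E × Nonempty A × ∣ A ∣ < ∣ E ∣ ×
                    ∣ A ∣ + (∣ K₁ ∣ + ∣ K₂ ∣) ≡ rank (A ∪ K₁) + rank (A ∪ K₂)

  tight? : ∀ K₁ K₂ E A → Dec (Tight K₁ K₂ E A)
  tight? K₁ K₂ E A = (A ⊆? E) ×-dec nonempty? A ×-dec (∣ A ∣ <? ∣ E ∣) ×-dec (_ ≟ _)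

  tight-swap : Tight K₂ K₁ E A → Tight K₁ K₂ E A
  tight-swap {K₂} {K₁} {A = A} (A⊆E , A-nonempty , ∣A∣<∣E∣ , tight) = A⊆E , A-nonempty , ∣A∣<∣E∣ ,
    trans (cong (∣ A ∣ +_) (+-comm ∣ K₁ ∣ ∣ K₂ ∣)) (trans tight (+-comm (rank (A ∪ K₂)) (rank (A ∪ K₁))))

  rado-insert : RadoCondition K₁ K₂ E → ¬ (∃[ A ] Tight K₁ K₂ E A) → e ∈ E → Addable K₁ e → Indep M K₂ →
                RadoCondition (⁅ e ⁆ ∪ K₁) K₂ (E - e)
  rado-insert {K₁} {K₂} {E} {e} rado no-tight e∈E (e∉K₁ , e+K₁-indep) K₂-indep B B⊆E-e with nonempty? B
  ... | no B-empty = begin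
    ∣ B ∣ + (∣ ⁅ e ⁆ ∪ K₁ ∣ + ∣ K₂ ∣) ≡⟨ cong (_+ _) (trans (cong ∣_∣ (Empty-unique B-empty)) (∣⊥∣≡0 n)) ⟩
    ∣ ⁅ e ⁆ ∪ K₁ ∣ + ∣ K₂ ∣          ≤⟨ +-mono-≤ (∣I∣≤rank (q⊆p∪q B (⁅ e ⁆ ∪ K₁)) e+K₁-indep)
                                                  (∣I∣≤rank (q⊆p∪q B K₂) K₂-indep) ⟩
    rank (B ∪ (⁅ e ⁆ ∪ K₁)) + rank (B ∪ K₂) ∎
    where open ≤-Reasoning
  ... | yes B-nonempty = begin
    ∣ B ∣ + (∣ ⁅ e ⁆ ∪ K₁ ∣ + ∣ K₂ ∣)
      ≡⟨ cong (λ k → ∣ B ∣ + (k + ∣ K₂ ∣)) (x∉p⇒∣⁅x⁆∪p∣≡1+∣p∣ e∉K₁) ⟩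
    ∣ B ∣ + suc (∣ K₁ ∣ + ∣ K₂ ∣)
      ≡⟨ +-suc ∣ B ∣ (∣ K₁ ∣ + ∣ K₂ ∣) ⟩
    suc (∣ B ∣ + (∣ K₁ ∣ + ∣ K₂ ∣))
      ≤⟨ ≤∧≢⇒< (rado B B⊆E) (λ tight → no-tight (B , B⊆E , B-nonempty , ∣B∣<∣E∣ , tight)) ⟩
    rank (B ∪ K₁) + rank (B ∪ K₂)
      ≤⟨ +-monoˡ-≤ (rank (B ∪ K₂)) (rank-mono (∪-mono ⊆-refl (q⊆p∪q ⁅ e ⁆ K₁))) ⟩
    rank (B ∪ (⁅ e ⁆ ∪ K₁)) + rank (B ∪ K₂) ∎
    where
    open ≤-Reasoning
    B⊆E : B ⊆ E
    B⊆E = ⊆-trans B⊆E-e (p─q⊆p E ⁅ e ⁆)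
    ∣B∣<∣E∣ : ∣ B ∣ < ∣ E ∣
    ∣B∣<∣E∣ = ≤-<-trans (p⊆q⇒∣p∣≤∣q∣ B⊆E-e) (x∈p⇒∣p-x∣<∣p∣ e∈E)

  ∣S∪K∣≤rank[A∪K] : IndepOver K A S → ∣ S ∪ K ∣ ≤ rank (A ∪ K)
  ∣S∪K∣≤rank[A∪K] S-over = ∣I∣≤rank (∪-mono (⊆E S-over) ⊆-refl) (indep S-over)

  cover-size : (C : Cover K₁ K₂ A) → ∣ A ∣ + (∣ K₁ ∣ + ∣ K₂ ∣) ≤ ∣ S₁ C ∪ K₁ ∣ + ∣ S₂ C ∪ K₂ ∣
  cover-size {K₁} {K₂} {A} C = begin
    ∣ A ∣ + (∣ K₁ ∣ + ∣ K₂ ∣)                 ≤⟨ +-monoˡ-≤ (∣ K₁ ∣ + ∣ K₂ ∣) ∣A∣≤∣S₁∣+∣S₂∣ ⟩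
    (∣ S₁ C ∣ + ∣ S₂ C ∣) + (∣ K₁ ∣ + ∣ K₂ ∣) ≡⟨ interchange (∣ S₁ C ∣) (∣ S₂ C ∣) (∣ K₁ ∣) (∣ K₂ ∣) ⟩
    (∣ S₁ C ∣ + ∣ K₁ ∣) + (∣ S₂ C ∣ + ∣ K₂ ∣) ≡⟨ cong₂ _+_ (Disjoint⇒∣p∪q∣≡∣p∣+∣q∣ (disjoint (part₁ C)))
                                                          (Disjoint⇒∣p∪q∣≡∣p∣+∣q∣ (disjoint (part₂ C))) ⟨
    ∣ S₁ C ∪ K₁ ∣ + ∣ S₂ C ∪ K₂ ∣             ∎
    where
    open ≤-Reasoning
    ∣A∣≤∣S₁∣+∣S₂∣ : ∣ A ∣ ≤ ∣ S₁ C ∣ + ∣ S₂ C ∣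
    ∣A∣≤∣S₁∣+∣S₂∣ = ≤-trans (p⊆q⇒∣p∣≤∣q∣ (covers C)) (∣p∪q∣≤∣p∣+∣q∣ (S₁ C) (S₂ C))

  tight-cover-spans : ∣ A ∣ + (∣ K₁ ∣ + ∣ K₂ ∣) ≡ rank (A ∪ K₁) + rank (A ∪ K₂) → (C : Cover K₁ K₂ A) →
                      rank (A ∪ K₁) ≤ ∣ S₁ C ∪ K₁ ∣ × rank (A ∪ K₂) ≤ ∣ S₂ C ∪ K₂ ∣
  tight-cover-spans {A} {K₁} {K₂} tight C =
    sum-squeeze (∣S∪K∣≤rank[A∪K] (part₁ C)) (∣S∪K∣≤rank[A∪K] (part₂ C))
                (subst (_≤ ∣ S₁ C ∪ K₁ ∣ + ∣ S₂ C ∪ K₂ ∣) tight (cover-size C))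
    where
    sum-squeeze : ∀ {x₁ x₂ y₁ y₂} → x₁ ≤ y₁ → x₂ ≤ y₂ → y₁ + y₂ ≤ x₁ + x₂ → y₁ ≤ x₁ × y₂ ≤ x₂
    sum-squeeze {x₁} {x₂} {y₁} {y₂} x₁≤y₁ x₂≤y₂ y≤x =
      +-cancelʳ-≤ y₂ y₁ x₁ (≤-trans y≤x (+-monoʳ-≤ x₁ x₂≤y₂)) ,
      +-cancelˡ-≤ y₁ y₂ x₂ (≤-trans y≤x (+-monoˡ-≤ x₂ x₁≤y₁))

  rado-split : RadoCondition K₁ K₂ E → Tight K₁ K₂ E A → (C : Cover K₁ K₂ A) →
               RadoCondition (S₁ C ∪ K₁) (S₂ C ∪ K₂) (E ─ A)
  rado-split {K₁} {K₂} {E} {A} rado (A⊆E , _ , _ , tight) C B B⊆E─A = begin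
    ∣ B ∣ + (∣ S₁ C ∪ K₁ ∣ + ∣ S₂ C ∪ K₂ ∣)
      ≤⟨ +-monoʳ-≤ ∣ B ∣ (+-mono-≤ (∣S∪K∣≤rank[A∪K] (part₁ C)) (∣S∪K∣≤rank[A∪K] (part₂ C))) ⟩
    ∣ B ∣ + (rank (A ∪ K₁) + rank (A ∪ K₂))
      ≡⟨ cong (∣ B ∣ +_) tight ⟨
    ∣ B ∣ + (∣ A ∣ + (∣ K₁ ∣ + ∣ K₂ ∣))
      ≡⟨ +-assoc ∣ B ∣ ∣ A ∣ (∣ K₁ ∣ + ∣ K₂ ∣) ⟨
    (∣ B ∣ + ∣ A ∣) + (∣ K₁ ∣ + ∣ K₂ ∣)
      ≡⟨ cong (_+ (∣ K₁ ∣ + ∣ K₂ ∣)) ∣B∣+∣A∣≡∣A∪B∣ ⟩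
    ∣ A ∪ B ∣ + (∣ K₁ ∣ + ∣ K₂ ∣)
      ≤⟨ rado (A ∪ B) (∪-least A⊆E (⊆-trans B⊆E─A (p─q⊆p E A))) ⟩
    rank ((A ∪ B) ∪ K₁) + rank ((A ∪ B) ∪ K₂)
      ≤⟨ +-mono-≤ (spanned (part₁ C) (proj₁ spans)) (spanned (part₂ C) (proj₂ spans)) ⟩
    rank (B ∪ (S₁ C ∪ K₁)) + rank (B ∪ (S₂ C ∪ K₂)) ∎
    where
    open ≤-Reasoning
    spans : rank (A ∪ K₁) ≤ ∣ S₁ C ∪ K₁ ∣ × rank (A ∪ K₂) ≤ ∣ S₂ C ∪ K₂ ∣
    spans = tight-cover-spans tight C
    ∣B∣+∣A∣≡∣A∪B∣ : ∣ B ∣ + ∣ A ∣ ≡ ∣ A ∪ B ∣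
    ∣B∣+∣A∣≡∣A∪B∣ = trans (+-comm ∣ B ∣ ∣ A ∣)
      (sym (Disjoint⇒∣p∪q∣≡∣p∣+∣q∣ (λ x∈A x∈B → x∈p─q⇒x∉q E A (B⊆E─A x∈B) x∈A)))
    spanned : IndepOver K A S → rank (A ∪ K) ≤ ∣ S ∪ K ∣ → rank ((A ∪ B) ∪ K) ≤ rank (B ∪ (S ∪ K))
    spanned {K} S-over S∪K-spans = ≤-trans
      (≤-reflexive (cong rank (trans (cong (_∪ K) (∪-comm A B)) (∪-assoc B A K))))
      (rank-∪-spanned (∪-mono (⊆E S-over) ⊆-refl) (indep S-over) S∪K-spans)

  partition-≤ : ∀ k → ∣ E ∣ ≤ k → Indep M K₁ → Indep M K₂ → RadoCondition K₁ K₂ E → Cover K₁ K₂ E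
  partition-≤ zero ∣E∣≤0 K₁-indep K₂-indep rado =
    cover-∅ K₁-indep K₂-indep (λ (e , e∈E) → n≮0 (<-≤-trans (x∈p⇒∣p-x∣<∣p∣ e∈E) ∣E∣≤0))
  partition-≤ {E} {K₁} {K₂} (suc k) ∣E∣≤1+k K₁-indep K₂-indep rado with anySubset? (tight? K₁ K₂ E)
  ... | yes (A , A-tight@(A⊆E , (x , x∈A) , ∣A∣<∣E∣ , _)) =
    cover-∪ A⊆E C (partition-≤ k ∣E─A∣≤k (indep (part₁ C)) (indep (part₂ C)) (rado-split rado A-tight C))
    where
    C : Cover K₁ K₂ A
    C = partition-≤ k (≤-pred (≤-trans ∣A∣<∣E∣ ∣E∣≤1+k)) K₁-indep K₂-indep
                      (λ B B⊆A → rado B (⊆-trans B⊆A A⊆E))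
    ∣E─A∣≤k : ∣ E ─ A ∣ ≤ k
    ∣E─A∣≤k = ≤-pred (≤-trans (p∩q≢∅⇒∣p─q∣<∣p∣ E A (x , x∈p∩q⁺ (A⊆E x∈A , x∈A))) ∣E∣≤1+k)
  ... | no no-tight with nonempty? E
  ...   | no  E-empty   = cover-∅ K₁-indep K₂-indep E-empty
  ...   | yes (e , e∈E) =
    [ insert rado no-tight K₂-indep
    , cover-swap ∘ insert (rado-swap rado) (no-tight ∘ map₂ tight-swap) K₁-indep
    ] (rado⇒addable rado K₁-indep K₂-indep e∈E)
    where
    insert : ∀ {K K′} → RadoCondition K K′ E → ¬ (∃[ A ] Tight K K′ E A) → Indep M K′ → Addable K e →
             Cover K K′ E
    insert cond ¬tight K′-indep e-addable = cover-insert e∈E e-addable K′-indep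
      (partition-≤ k (≤-pred (≤-trans (x∈p⇒∣p-x∣<∣p∣ e∈E) ∣E∣≤1+k)) (proj₂ e-addable) K′-indep
        (rado-insert cond ¬tight e∈E e-addable K′-indep))

  partition : Indep M K₁ → Indep M K₂ → RadoCondition K₁ K₂ E → Cover K₁ K₂ E
  partition = partition-≤ _ ≤-refl

  indep⇒rado : Indep M (K₁ ∪ K₂) → K₁ ∩ K₂ ≡ ⊥ → Indep M E → RadoCondition K₁ K₂ E
  indep⇒rado {K₁} {K₂} K₁∪K₂-indep K₁∩K₂≡⊥ E-indep A A⊆E = begin
    ∣ A ∣ + (∣ K₁ ∣ + ∣ K₂ ∣)
      ≡⟨ cong (∣ A ∣ +_) (p∩q≡⊥⇒∣p∪q∣≡∣p∣+∣q∣ K₁ K₂ K₁∩K₂≡⊥) ⟨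
    ∣ A ∣ + ∣ K₁ ∪ K₂ ∣
      ≡⟨ +-comm ∣ A ∣ ∣ K₁ ∪ K₂ ∣ ⟩
    ∣ K₁ ∪ K₂ ∣ + ∣ A ∣
      ≤⟨ +-mono-≤ (∣I∣≤rank (∪-mono (q⊆p∪q A K₁) (q⊆p∪q A K₂)) K₁∪K₂-indep)
                  (∣I∣≤rank (∩-greatest (p⊆p∪q K₁) (p⊆p∪q K₂)) (indep-⊆ M A⊆E E-indep)) ⟩
    rank ((A ∪ K₁) ∪ (A ∪ K₂)) + rank ((A ∪ K₁) ∩ (A ∪ K₂))
      ≤⟨ rank-submodular (A ∪ K₁) (A ∪ K₂) ⟩
    rank (A ∪ K₁) + rank (A ∪ K₂) ∎
    where open ≤-Reasoning

module _ {n : ℕ} (M : Matroid n) where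
  open import Data.Nat using (zero; suc; _+_; _^_; _≤_; _<_; _<?_)
  open import Data.Nat.Properties
  open import Data.List using (List; []; _∷_)
  open import Data.List.Relation.Unary.All as All using (All; []; _∷_)
  open import Data.List.Relation.Unary.Any as Any using (Any; here; there)
  import Data.Fin.Properties as Fin
  open import Relation.Nullary.Decidable using (_×-dec_; ¬?)

  private
    variable
      L : List (Subset n)
      X Y : Subset n

  Below : List (Subset n) → Subset n → Set
  Below L X = Any (X ⊆_) L

  below? : ∀ L → Decidable (Below L)
  below? L X = Any.any? (X ⊆?_) L

  Below-⊆ : X ⊆ Y → Below L Y → Below L X
  Below-⊆ X⊆Y = Any.map (⊆-trans X⊆Y)

  Below-indep : All (Indep M) L → Below L X → Indep M X
  Below-indep (Y-indep ∷ _) (here X⊆Y) = indep-⊆ M X⊆Y Y-indep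
  Below-indep (_ ∷ L-indep) (there X-below) = Below-indep L-indep X-below

  Exchange : (Subset n → Set) → Set
  Exchange F = ∀ {A B} → F A → F B → ∣ A ∣ < ∣ B ∣ → ∃[ x ] (x ∈ B × x ∉ A × F (A ∪ ⁅ x ⁆))

  private
    Augmentable : List (Subset n) → Subset n → Subset n → Set
    Augmentable L A B = ∃[ x ] (x ∈ B × x ∉ A × Below L (A ∪ ⁅ x ⁆))

    augmentable? : ∀ L A B → Dec (Augmentable L A B)
    augmentable? L A B = Fin.any? λ x → (x ∈? B) ×-dec (¬? (x ∈? A) ×-dec below? L (A ∪ ⁅ x ⁆))

    Violation : List (Subset n) → Set
    Violation L = ∃[ A ] ∃[ B ] (Below L A × Below L B × ∣ A ∣ < ∣ B ∣ × ¬ Augmentable L A B)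

    violation? : ∀ L → Dec (Violation L)
    violation? L = anySubset? λ A → anySubset? λ B →
      below? L A ×-dec (below? L B ×-dec ((∣ A ∣ <? ∣ B ∣) ×-dec ¬? (augmentable? L A B)))

  record ExchangeClosure (L : List (Subset n)) : Set where
    field
      sets     : List (Subset n)
      indep    : All (Indep M) sets
      ⊇L       : ∀ {X} → Below L X → Below sets X
      exchange : Exchange (Below sets)

  -- Each round adds an independent set that is not yet below the list, so the number of sets below
  -- the list grows; as it never exceeds 2 ^ n, the fuel k cannot run out.
  exchangeClosure : ∀ k → All (Indep M) L → 2 ^ n < count (below? L) + k → ExchangeClosure L
  exchangeClosure {L} zero _ 2^n<count =
    contradiction (subst (2 ^ n <_) (+-identityʳ _) 2^n<count) (≤⇒≯ (count≤2^ (below? L)))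
  exchangeClosure {L} (suc k) L-indep 2^n<count with violation? L
  ... | no no-violation = record { sets = L ; indep = L-indep ; ⊇L = λ below → below ; exchange = exchange }
    where
    exchange : Exchange (Below L)
    exchange {A} {B} A-below B-below ∣A∣<∣B∣ with augmentable? L A B
    ... | yes augmentable = augmentable
    ... | no ¬augmentable = contradiction (A , B , A-below , B-below , ∣A∣<∣B∣ , ¬augmentable) no-violation
  ... | yes (A , B , A-below , B-below , ∣A∣<∣B∣ , ¬augmentable)
    with indep-exch M (Below-indep L-indep A-below) (Below-indep L-indep B-below) ∣A∣<∣B∣
  ...   | x , x∈B , x∉A , A+x-indep = record
    { sets = sets ; indep = indep ; ⊇L = λ below → ⊇L (there below) ; exchange = exchange }
    where
    L′ : List (Subset n)
    L′ = (A ∪ ⁅ x ⁆) ∷ L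
    count-grows : count (below? L) < count (below? L′)
    count-grows = count-mono-< (below? L) (below? L′) there (A ∪ ⁅ x ⁆) (here ⊆-refl)
                    (λ below → ¬augmentable (x , x∈B , x∉A , below))
    open ExchangeClosure (exchangeClosure k (A+x-indep ∷ L-indep)
      (<-≤-trans 2^n<count (subst (_≤ count (below? L′) + k) (sym (+-suc _ k)) (+-monoˡ-≤ k count-grows))))

  -- Independence in M need not be decidable, but the rank function needs it: the subsets of the
  -- exchange closure of finitely many independent sets form a matroid with decidable independence.
  record DecidableSubmatroid (L : List (Subset n)) : Set₁ where
    field
      matroid : Matroid n
      indep?  : Decidable (Indep matroid)
      sound   : ∀ {X} → Indep matroid X → Indep M X
      indep-L : All (Indep matroid) L

  decidableSubmatroid : ∀ L → All (Indep M) L → DecidableSubmatroid L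
  decidableSubmatroid L L-indep = record
    { matroid = record
      { Indep      = Below sets
      ; indep-∅    = ⊇L (here ⊆-refl)
      ; indep-⊆    = Below-⊆
      ; indep-exch = exchange
      }
    ; indep?  = below? sets
    ; sound   = Below-indep indep
    ; indep-L = All.tabulate λ X∈L → ⊇L (there (Any.map ⊆-reflexive X∈L))
    }
    where
    open ExchangeClosure (exchangeClosure (suc (2 ^ n)) (indep-∅ M ∷ L-indep)
      (≤-trans (n<1+n (2 ^ n)) (m≤n+m (suc (2 ^ n)) _)))

module _ where
  open import Data.Nat as ℕ using (suc; _^_; NonZero)
  import Data.Nat.Properties as ℕ
  open import Data.Nat.Coprimality using (1-coprimeTo) renaming (sym to coprime-sym)
  open import Data.Integer as ℤ using (+_)
  import Data.Integer.Properties as ℤ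
  open import Data.Rational using (ℚ; mkℚ; 0ℚ; 1ℚ; _+_; _*_; _≤_; _/_; 1/_)
  open import Data.Rational.Properties
  open import Data.List using (List; []; _∷_; length; map; _++_)
  open import Data.List.Properties using (length-map; length-++)

  ι : ℕ → ℚ
  ι m = + m / 1

  ι≡mkℚ : ∀ m → ι m ≡ mkℚ (+ m) 0 (coprime-sym (1-coprimeTo m))
  ι≡mkℚ m = normalize-coprime (coprime-sym (1-coprimeTo m))

  ι-suc : ∀ m → ι (suc m) ≡ 1ℚ + ι m
  ι-suc m = begin
    + suc m / 1                                    ≡⟨ cong (λ k → (+ 1 ℤ.+ k) / 1) (ℤ.*-identityʳ (+ m)) ⟨
    (+ 1 ℤ.+ + m ℤ.* + 1) / 1                      ≡⟨⟩
    1ℚ + mkℚ (+ m) 0 (coprime-sym (1-coprimeTo m)) ≡⟨ cong (_+_ 1ℚ) (ι≡mkℚ m) ⟨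
    1ℚ + ι m                                       ∎
    where open ≡-Reasoning

  1/m*ι[m]≡1 : ∀ m .{{_ : NonZero m}} → (+ 1 / m) * ι m ≡ 1ℚ
  1/m*ι[m]≡1 (suc j) = begin
    (+ 1 / suc j) * ι (suc j) ≡⟨ cong₂ _*_ (normalize-coprime (1-coprimeTo (suc j))) (ι≡mkℚ (suc j)) ⟩
    1/ ι′ * ι′                ≡⟨ *-inverseˡ ι′ ⟩
    1ℚ                        ∎
    where
    open ≡-Reasoning
    ι′ : ℚ
    ι′ = mkℚ (+ suc j) 0 (coprime-sym (1-coprimeTo (suc j)))

  module _ {A : Set} (g : A → ℚ) {q : ℚ} (q≤g : ∀ x → q ≤ g x) where

    ι[length]*lower≤sum : ∀ xs → ι (length xs) * q ≤ sumℚ (map g xs)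
    ι[length]*lower≤sum []       = ≤-reflexive (*-zeroˡ q)
    ι[length]*lower≤sum (x ∷ xs) = begin
      ι (suc (length xs)) * q     ≡⟨ cong (_* q) (ι-suc (length xs)) ⟩
      (1ℚ + ι (length xs)) * q    ≡⟨ *-distribʳ-+ q 1ℚ (ι (length xs)) ⟩
      1ℚ * q + ι (length xs) * q  ≡⟨ cong (_+ ι (length xs) * q) (*-identityˡ q) ⟩
      q + ι (length xs) * q       ≤⟨ +-mono-≤ (q≤g x) (ι[length]*lower≤sum xs) ⟩
      g x + sumℚ (map g xs)       ∎
      where open ≤-Reasoning

    lower≤average : ∀ xs m .{{_ : NonZero m}} → length xs ≡ m → q ≤ (+ 1 / m) * sumℚ (map g xs)
    lower≤average xs m refl = begin
      q                                    ≡⟨ *-identityˡ q ⟨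
      1ℚ * q                               ≡⟨ cong (_* q) (1/m*ι[m]≡1 m) ⟨
      (+ 1 / m) * ι m * q                  ≡⟨ *-assoc (+ 1 / m) (ι m) q ⟩
      (+ 1 / m) * (ι m * q)                ≤⟨ *-monoˡ-≤-nonNeg (+ 1 / m) {{normalize-nonNeg 1 m}}
                                                                   (ι[length]*lower≤sum xs) ⟩
      (+ 1 / m) * sumℚ (map g xs)          ∎
      where open ≤-Reasoning

  length-subsetsOf : ∀ (H : Subset n) → length (subsetsOf H) ≡ 2 ^ ∣ H ∣
  length-subsetsOf []            = refl
  length-subsetsOf (outside ∷ H) = trans (length-map (outside ∷_) (subsetsOf H)) (length-subsetsOf H)
  length-subsetsOf (inside ∷ H)  = begin
    length (map (outside ∷_) (subsetsOf H) ++ map (inside ∷_) (subsetsOf H))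
      ≡⟨ length-++ (map (outside ∷_) (subsetsOf H)) ⟩
    length (map (outside ∷_) (subsetsOf H)) ℕ.+ length (map (inside ∷_) (subsetsOf H))
      ≡⟨ cong₂ ℕ._+_ (length-map (outside ∷_) (subsetsOf H)) (length-map (inside ∷_) (subsetsOf H)) ⟩
    length (subsetsOf H) ℕ.+ length (subsetsOf H)
      ≡⟨ cong (λ k → k ℕ.+ k) (length-subsetsOf H) ⟩
    2 ^ ∣ H ∣ ℕ.+ 2 ^ ∣ H ∣
      ≡⟨ cong (2 ^ ∣ H ∣ ℕ.+_) (ℕ.+-identityʳ (2 ^ ∣ H ∣)) ⟨
    2 ^ suc ∣ H ∣ ∎
    where open ≡-Reasoning

  module _ {f : SetFun n} where

    f≤h : Monotone f → ∀ H S → f S ≤ h f H S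
    f≤h f-mono H S = lower≤average (λ Hj → f (S ∪ Hj)) (λ Hj → f-mono S (S ∪ Hj) (p⊆p∪q Hj))
                       (subsetsOf H) (2 ^ ∣ H ∣) {{ℕ.m^n≢0 2 ∣ H ∣}} (length-subsetsOf H)

    subadditive : NonNeg f → Submodular f → ∀ S T → f (S ∪ T) ≤ f S + f T
    subadditive f≥0 f-submod S T = begin
      f (S ∪ T)             ≡⟨ +-identityʳ (f (S ∪ T)) ⟨
      f (S ∪ T) + 0ℚ        ≤⟨ +-monoʳ-≤ (f (S ∪ T)) (f≥0 (S ∩ T)) ⟩
      f (S ∪ T) + f (S ∩ T) ≤⟨ f-submod S T ⟩
      f S + f T             ∎
      where open ≤-Reasoning

    covered⇒≤h+h : NonNeg f → Monotone f → Submodular f → ∀ H₁ H₂ {O S₁ S₂} → O ⊆ S₁ ∪ S₂ →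
                   f O ≤ h f H₁ S₁ + h f H₂ S₂
    covered⇒≤h+h f≥0 f-mono f-submod H₁ H₂ {O} {S₁} {S₂} O⊆S₁∪S₂ = begin
      f O                     ≤⟨ f-mono O (S₁ ∪ S₂) O⊆S₁∪S₂ ⟩
      f (S₁ ∪ S₂)             ≤⟨ subadditive f≥0 f-submod S₁ S₂ ⟩
      f S₁ + f S₂             ≤⟨ +-mono-≤ (f≤h f-mono H₁ S₁) (f≤h f-mono H₂ S₂) ⟩
      h f H₁ S₁ + h f H₂ S₂   ∎
      where open ≤-Reasoning

indepRel-cover : ∀ {n} (M : Matroid n) {H₁ H₂ O : Subset n} → Indep M (H₁ ∪ H₂) → H₁ ∩ H₂ ≡ ⊥ → Indep M O →
                 ∃[ S₁ ] ∃[ S₂ ] (IndepRel M H₁ S₁ × IndepRel M H₂ S₂ × O ⊆ S₁ ∪ S₂)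
indepRel-cover M {H₁} {H₂} {O} H-indep H₁∩H₂≡⊥ O-indep =
  S₁ C , S₂ C , indepRel (part₁ C) , indepRel (part₂ C) , covers C
  where
  open DecidableSubmatroid (decidableSubmatroid M (O ∷ H₁ ∪ H₂ ∷ []) (O-indep ∷ H-indep ∷ []))
  open Partition matroid indep?
  open Cover
  C : Cover H₁ H₂ O
  C = partition (indep-⊆ matroid (p⊆p∪q H₂) H-indep′) (indep-⊆ matroid (q⊆p∪q H₁ H₂) H-indep′)
                (indep⇒rado H-indep′ H₁∩H₂≡⊥ O-indep′)
    where
    O-indep′ : Indep matroid O
    O-indep′ = All.head indep-L
    H-indep′ : Indep matroid (H₁ ∪ H₂)
    H-indep′ = All.head (All.tail indep-L)
  indepRel : ∀ {K S} → IndepOver K O S → IndepRel M K S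
  indepRel S-over = Disjoint⇒∩≡⊥ (IndepOver.disjoint S-over) , sound (IndepOver.indep S-over)

open import Data.Rational using (_+_; _≤_)

lemma5p10 : (n : ℕ) (M : Matroid n) (f : SetFun n) →
    NonNeg f → Monotone f → Submodular f →
    (B₀ H₁ H₂ : Subset n) → IsBasis M B₀ → H₁ ∪ H₂ ≡ B₀ → H₁ ∩ H₂ ≡ ⊥ →
    (O : Subset n) → IsArgMax M f O →
    ∃[ S₁ ] ∃[ S₂ ] (IndepRel M H₁ S₁ × IndepRel M H₂ S₂ ×
      f O ≤ h f H₁ S₁ + h f H₂ S₂)
lemma5p10 n M f f≥0 f-mono f-submod _ H₁ H₂ (B₀-indep , _) refl H₁∩H₂≡⊥ O (O-indep , _) =
  let S₁ , S₂ , S₁-indepRel , S₂-indepRel , O⊆S₁∪S₂ = indepRel-cover M B₀-indep H₁∩H₂≡⊥ O-indep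
  in S₁ , S₂ , S₁-indepRel , S₂-indepRel , covered⇒≤h+h f≥0 f-mono f-submod H₁ H₂ O⊆S₁∪S₂
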